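{- Let $i\ge 7$, let $(s,e)$ be an occurrence in $F_i$, and let $S:=F_i[s\ldots e]$. If $(s,e)$ is a super-occurrence of some occurrence of $F_{i-3}$, and $S$ is neither $F_{i-2}$ nor $F_{i-2}\,Q_i$, then $(s,e)$ is not a net occurrence.
   Context: Fibonacci words: $F_1=\texttt{b}$, $F_2=\texttt{a}$, $F_k=F_{k-1}F_{k-2}$ for $k\ge 3$. For $i\ge 7$, $Q_i:=F_{i-5}F_{i-6}\cdots F_3F_2$. Positions are 1-indexed; $T[i\ldots j]$ is a substring. An occurrence in a text $T$ of length $n$ is a pair $(i,j)$ with $1\le i\le j\le n$, an occurrence of $S$ if $T[i\ldots j]=S$. $(i,j)$ is a super-occurrence of $(i',j')$ if $i\le i'\le j'\le j$. A string is unique in $T$ if it occurs exactly once and repeated if it occurs at least twice. $(i,j)$ is a net occurrence if $T[i\ldots j]$ is repeated while $T[i-1\ldots j]$ and $T[i\ldots j+1]$ are unique (with $T[i-1\ldots j]$ regarded unique when $i=1$ and $T[i\ldots j+1]$ regarded unique when $j=n$). -}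

module Defs where

open import Data.Nat using (ℕ; zero; suc; _+_; _∸_; _≤_; _<_)
open import Data.List using (List; []; _∷_; _++_; length; take; drop)
open import Data.Product using (Σ; _×_; _,_; ∃; ∃-syntax)
open import Data.Unit using (⊤)
open import Data.Sum using (_⊎_)
open import Relation.Binary.PropositionalEquality using (_≡_)
open import Relation.Nullary using (¬_)

data Letter : Set where
  a b : Letter

Word : Set
Word = List Letter

-- Fibonacci words: F 1 = b, F 2 = a, F k = F (k-1) F (k-2) for k ≥ 3.
-- (F 0 is a dummy value, never used.)
F : ℕ → Word
F zero = []
F (suc zero) = b ∷ []
F (suc (suc zero)) = a ∷ []
F (suc (suc (suc k))) = F (suc (suc k)) ++ F (suc k)

Q' : ℕ → Word
Q' zero = []
Q' (suc zero) = []
Q' (suc (suc m)) = F (suc (suc m)) ++ Q' (suc m)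

Q : ℕ → Word
Q i = Q' (i ∸ 5)

-- T[i … j] (1-indexed, inclusive)
sub : Word → ℕ → ℕ → Word
sub T i j = take (suc j ∸ i) (drop (i ∸ 1) T)

IsOcc : Word → ℕ → ℕ → Set
IsOcc T i j = (1 ≤ i) × (i ≤ j) × (j ≤ length T)

OccOf : Word → Word → ℕ → ℕ → Set
OccOf T S i j = IsOcc T i j × (sub T i j ≡ S)

Unique : Word → Word → Set
Unique T S = Σ ℕ λ i → Σ ℕ λ j → OccOf T S i j ×
  (∀ i' j' → OccOf T S i' j' → (i' ≡ i) × (j' ≡ j))

Repeated : Word → Word → Set
Repeated T S = Σ ℕ λ i → Σ ℕ λ j → Σ ℕ λ i' → Σ ℕ λ j' →
  OccOf T S i j × OccOf T S i' j' × ¬ ((i ≡ i') × (j ≡ j'))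

-- left extension T[i-1 … j] unique (regarded unique when i = 1)
LeftExtUnique : Word → ℕ → ℕ → Set
LeftExtUnique T zero j = Unique T (sub T zero j)
LeftExtUnique T (suc zero) j = ⊤
LeftExtUnique T (suc (suc i)) j = Unique T (sub T (suc i) j)

-- right extension T[i … j+1] unique (regarded unique when j = n)
RightExtUnique : Word → ℕ → ℕ → Set
RightExtUnique T i j = (j ≡ length T) ⊎ Unique T (sub T i (suc j))

IsNet : Word → ℕ → ℕ → Set
IsNet T i j = IsOcc T i j × Repeated T (sub T i j) ×
  LeftExtUnique T i j × RightExtUnique T i j

Super : ℕ → ℕ → ℕ → ℕ → Set
Super s e s' e' = (s ≤ s') × (s' ≤ e') × (e' ≤ e)

{-# OPTIONS --safe #-}

-- The morphism φ (a ↦ ab, b ↦ a) maps F n to F (1 + n), and every a of a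
-- φ-image begins the image of a letter; desubstituting along φ shows that F (i - 3) occurs in
-- F i only right after the prefixes ε, F (i - 3), F (i - 2), F (i - 1) (the base case is computed).
-- The copy of F (i - 3) inside a net occurrence S therefore lies at two of these four places,
-- once for each of two occurrences of S, and since neither one-letter extension of S is repeated,
-- S is exactly the maximal common extension of those two places. The near-commutation
-- F (1 + n) F n = Q' n x y, F n F (1 + n) = Q' n y x (x ≠ y) identifies these extensions as
-- F (i - 2), F (i - 2) Q i and F (i - 4) Q i; the last is never net, because wherever it is
-- preceded or followed by x, that extension also occurs elsewhere.
module Submission where

open import Defs
open import Data.Bool using (Bool; true; false; if_then_else_)
open import Data.Empty using (⊥; ⊥-elim)
open import Data.List using (List; []; _∷_; _++_; _∷ʳ_; length; reverse; take; drop; map)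
open import Data.List.Properties
open import Data.List.Membership.Propositional using (_∈_)
open import Data.List.Membership.Propositional.Properties using (∈-++⁺ʳ; ∈-map⁺)
open import Data.List.Relation.Unary.Any using (here; there)
open import Data.Nat using (ℕ; zero; suc; _+_; _∸_; _≤_; _<_; z≤n; s≤s; _≟_)
open import Data.Nat.Properties
open import Data.Product using (Σ; _×_; _,_; proj₁; proj₂)
open import Data.Sum as Sum using (_⊎_; inj₁; inj₂; [_,_]′; map₁)
open import Function using (_∘_)
open import Relation.Binary.PropositionalEquality
open import Relation.Nullary using (¬_; yes; no)

-- Common prefixes and suffixes

length-∷ʳ : ∀ (xs : Word) x → length (xs ∷ʳ x) ≡ suc (length xs)
length-∷ʳ xs x = trans (length-++ xs) (+-comm (length xs) 1)

drop-length-++ : ∀ (xs ys : Word) → drop (length xs) (xs ++ ys) ≡ ys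
drop-length-++ []       ys = refl
drop-length-++ (x ∷ xs) ys = drop-length-++ xs ys

take-length-++ : ∀ (xs ys : Word) → take (length xs) (xs ++ ys) ≡ xs
take-length-++ []       ys = refl
take-length-++ (x ∷ xs) ys = cong (x ∷_) (take-length-++ xs ys)

++-split-≤ : ∀ (A Y A′ Y′ : Word) → A ++ Y ≡ A′ ++ Y′ → length A ≤ length A′ →
             Σ Word λ U → A′ ≡ A ++ U × Y ≡ U ++ Y′
++-split-≤ []      Y A′       Y′ eq _         = A′ , refl , eq
++-split-≤ (x ∷ A) Y (_ ∷ A′) Y′ eq (s≤s A≤A′) with refl , eq′ ← ∷-injective eq
  with U , refl , refl ← ++-split-≤ A Y A′ Y′ eq′ A≤A′ = U , refl , refl

ends-with : ∀ (P : Word) u v → P ++ u ∷ v ∷ [] ≡ (P ∷ʳ u) ∷ʳ v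
ends-with P u v = sym (++-assoc P (u ∷ []) (v ∷ []))

SameHead : Word → Word → Set
SameHead R R′ = Σ Letter λ d → Σ Word λ R₀ → Σ Word λ R₀′ → R ≡ d ∷ R₀ × R′ ≡ d ∷ R₀′

SameLast : Word → Word → Set
SameLast L L′ = Σ Letter λ c → Σ Word λ L₀ → Σ Word λ L₀′ → L ≡ L₀ ∷ʳ c × L′ ≡ L₀′ ∷ʳ c

shared-prefix : ∀ (Z B B′ W R R′ : Word) → Z ++ B ≡ W ++ R → Z ++ B′ ≡ W ++ R′ → ¬ SameHead R R′ →
                Z ≡ W ⊎ SameHead B B′
shared-prefix []      B B′ []      R R′ e e′ R≉R′ = inj₁ refl
shared-prefix []      B B′ (w ∷ W) R R′ e e′ R≉R′ = inj₂ (w , W ++ R , W ++ R′ , e , e′)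
shared-prefix (z ∷ Z) B B′ []      R R′ e e′ R≉R′ = ⊥-elim (R≉R′ (z , Z ++ B , Z ++ B′ , sym e , sym e′))
shared-prefix (z ∷ Z) B B′ (w ∷ W) R R′ e e′ R≉R′
  with refl , e₀ ← ∷-injective e | _ , e₀′ ← ∷-injective e′ =
  map₁ (cong (z ∷_)) (shared-prefix Z B B′ W R R′ e₀ e₀′ R≉R′)

SameHead-reverse⇒SameLast : ∀ L L′ → SameHead (reverse L) (reverse L′) → SameLast L L′
SameHead-reverse⇒SameLast L L′ (d , R₀ , R₀′ , e , e′) =
  d , reverse R₀ , reverse R₀′ , from-reverse L R₀ e , from-reverse L′ R₀′ e′
  where
  from-reverse : ∀ X R₀ → reverse X ≡ d ∷ R₀ → X ≡ reverse R₀ ∷ʳ d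
  from-reverse X R₀ e = begin
    X                          ≡⟨ sym (reverse-involutive X) ⟩
    reverse (reverse X)        ≡⟨ cong reverse e ⟩
    reverse (d ∷ R₀)           ≡⟨ reverse-++ (d ∷ []) R₀ ⟩
    reverse R₀ ∷ʳ d            ∎
    where open ≡-Reasoning

shared-suffix : ∀ (A A′ U L L′ W : Word) → A ++ U ≡ L ++ W → A′ ++ U ≡ L′ ++ W → ¬ SameLast L L′ →
                U ≡ W ⊎ SameLast A A′
shared-suffix A A′ U L L′ W e e′ L≉L′ =
  Sum.map reverse-injective (SameHead-reverse⇒SameLast A A′)
    (shared-prefix (reverse U) (reverse A) (reverse A′) (reverse W) (reverse L) (reverse L′)
                   (reversed e) (reversed e′) (L≉L′ ∘ SameHead-reverse⇒SameLast L L′))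
  where
  reversed : ∀ {X Y} → X ++ U ≡ Y ++ W → reverse U ++ reverse X ≡ reverse W ++ reverse Y
  reversed {X} {Y} e = trans (sym (reverse-++ X U)) (trans (cong reverse e) (reverse-++ Y W))

¬SameLast-∷ʳ : ∀ {L L′ L₀ L₀′ x y} → x ≢ y → L ≡ L₀ ∷ʳ x → L′ ≡ L₀′ ∷ʳ y → ¬ SameLast L L′
¬SameLast-∷ʳ x≢y refl refl (c , _ , _ , e , e′) =
  x≢y (trans (proj₂ (∷ʳ-injective _ _ e)) (sym (proj₂ (∷ʳ-injective _ _ e′))))

¬SameHead-∷ : ∀ {u v R R′} → u ≢ v → ¬ SameHead (u ∷ R) (v ∷ R′)
¬SameHead-∷ u≢v (_ , _ , _ , refl , refl) = u≢v refl

¬SameHead-[]ʳ : ∀ R → ¬ SameHead R []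
¬SameHead-[]ʳ R (_ , _ , _ , _ , ())

¬SameLast-[]ˡ : ∀ L′ → ¬ SameLast [] L′
¬SameLast-[]ˡ L′ (c , L₀ , _ , e , _) with () ← ++-conicalʳ L₀ (c ∷ []) (sym e)

-- Occurrences as factorisations

Factorisation : Word → Word → ℕ → ℕ → Set
Factorisation T W i j = Σ Word λ A → Σ Word λ B → T ≡ A ++ W ++ B × i ≡ suc (length A) × j ≡ length A + length W

occurrence⇒factorisation : ∀ {T W i j} → OccOf T W i j → Factorisation T W i j
occurrence⇒factorisation {T} {_} {suc i} {j} ((_ , i<j , j≤n) , refl) =
  take i T , drop j T , T≡ , cong suc (sym |A|≡i) , sym j≡
  where
  i≤j : i ≤ j
  i≤j = ≤-trans (n≤1+n i) i<j
  T≡ : T ≡ take i T ++ take (j ∸ i) (drop i T) ++ drop j T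
  T≡ = begin
    T                                                               ≡⟨ sym (take++drop≡id i T) ⟩
    take i T ++ drop i T                                            ≡⟨ cong (take i T ++_) (sym (take++drop≡id (j ∸ i) _)) ⟩
    take i T ++ take (j ∸ i) (drop i T) ++ drop (j ∸ i) (drop i T)  ≡⟨ cong (λ R → take i T ++ take (j ∸ i) (drop i T) ++ R) drop-j ⟩
    take i T ++ take (j ∸ i) (drop i T) ++ drop j T                 ∎
    where
    open ≡-Reasoning
    drop-j : drop (j ∸ i) (drop i T) ≡ drop j T
    drop-j = trans (drop-drop i (j ∸ i) T) (cong (λ n → drop n T) (m+[n∸m]≡n i≤j))
  |A|≡i : length (take i T) ≡ i
  |A|≡i = trans (length-take i T) (m≤n⇒m⊓n≡m (≤-trans i≤j j≤n))
  |W|≡j∸i : length (take (j ∸ i) (drop i T)) ≡ j ∸ i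
  |W|≡j∸i = trans (length-take (j ∸ i) (drop i T))
              (m≤n⇒m⊓n≡m (subst (j ∸ i ≤_) (sym (length-drop i T)) (∸-monoˡ-≤ i j≤n)))
  j≡ : length (take i T) + length (take (j ∸ i) (drop i T)) ≡ j
  j≡ = trans (cong₂ _+_ |A|≡i |W|≡j∸i) (m+[n∸m]≡n i≤j)

sub-factorisation : ∀ {T} A W B → T ≡ A ++ W ++ B → sub T (suc (length A)) (length A + length W) ≡ W
sub-factorisation A W B refl rewrite m+n∸m≡n (length A) (length W) | drop-length-++ A (W ++ B) = take-length-++ W B

factorisation⇒occurrence : ∀ {T} A W B → T ≡ A ++ W ++ B → 0 < length W →
                           OccOf T W (suc (length A)) (length A + length W)
factorisation⇒occurrence A W B refl 0<|W| =
  (s≤s z≤n , m<m+n (length A) 0<|W| , |A|+|W|≤|T|) , sub-factorisation A W B refl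
  where
  |A|+|W|≤|T| : length A + length W ≤ length (A ++ W ++ B)
  |A|+|W|≤|T| = subst (length A + length W ≤_)
    (sym (trans (length-++ A) (cong (length A +_) (length-++ W))))
    (+-monoʳ-≤ (length A) (m≤m+n (length W) (length B)))

AtMostOnce : Word → Word → Set
AtMostOnce T W = ∀ A₁ B₁ A₂ B₂ → T ≡ A₁ ++ W ++ B₁ → T ≡ A₂ ++ W ++ B₂ → length A₁ ≡ length A₂

Unique⇒AtMostOnce : ∀ {T W} → 0 < length W → Unique T W → AtMostOnce T W
Unique⇒AtMostOnce {W = W} 0<|W| (i , j , _ , only) A₁ B₁ A₂ B₂ e₁ e₂ = suc-injective (trans
  (proj₁ (only _ _ (factorisation⇒occurrence A₁ W B₁ e₁ 0<|W|)))
  (sym (proj₁ (only _ _ (factorisation⇒occurrence A₂ W B₂ e₂ 0<|W|)))))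

-- Net occurrences and maximal repeats

record NetOccurrence (T A S B : Word) : Set where
  field
    split        : T ≡ A ++ S ++ B
    A′ B′        : Word
    split′       : T ≡ A′ ++ S ++ B′
    distinct     : length A ≢ length A′
    left-unique  : ∀ A₀ c → A ≡ A₀ ∷ʳ c → AtMostOnce T (c ∷ S)
    right-unique : ∀ d B₀ → B ≡ d ∷ B₀ → AtMostOnce T (S ∷ʳ d)

another-occurrence : ∀ {T} (A S B : Word) → T ≡ A ++ S ++ B → Repeated T S →
                     Σ Word λ A′ → Σ Word λ B′ → T ≡ A′ ++ S ++ B′ × length A ≢ length A′
another-occurrence A S B _ (i₁ , j₁ , i₂ , j₂ , occ₁ , occ₂ , ≢₁₂)
  with occurrence⇒factorisation occ₁ | occurrence⇒factorisation occ₂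
... | A₁ , B₁ , e₁ , refl , refl | A₂ , B₂ , e₂ , refl , refl with length A ≟ length A₁
... | no  ≢₁ = A₁ , B₁ , e₁ , ≢₁
... | yes |A|≡|A₁| =
  A₂ , B₂ , e₂ , λ |A|≡|A₂| → ≢₁₂ (cong suc (same |A|≡|A₂|) , cong (_+ length S) (same |A|≡|A₂|))
  where
  same : length A ≡ length A₂ → length A₁ ≡ length A₂
  same = trans (sym |A|≡|A₁|)

left-extension-unique : ∀ {T} (A₀ : Word) c (S B : Word) → T ≡ (A₀ ∷ʳ c) ++ S ++ B →
  LeftExtUnique T (suc (length (A₀ ∷ʳ c))) (length (A₀ ∷ʳ c) + length S) → Unique T (c ∷ S)
left-extension-unique {T} A₀ c S B e unique rewrite length-∷ʳ A₀ c =
  subst (Unique T) (trans (cong (sub T (suc (length A₀))) (sym (+-suc (length A₀) (length S))))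
                          (sub-factorisation A₀ (c ∷ S) B (trans e (++-assoc A₀ (c ∷ []) (S ++ B)))))
        unique

right-extension-unique : ∀ {T} (A S : Word) d (B₀ : Word) → T ≡ A ++ S ++ d ∷ B₀ →
  RightExtUnique T (suc (length A)) (length A + length S) → Unique T (S ∷ʳ d)
right-extension-unique A S d B₀ refl (inj₁ at-end) = ⊥-elim (m+1+n≢m (length A + length S) (sym (trans at-end |T|)))
  where
  |T| : length (A ++ S ++ d ∷ B₀) ≡ (length A + length S) + suc (length B₀)
  |T| = trans (length-++ A) (trans (cong (length A +_) (length-++ S)) (sym (+-assoc (length A) _ _)))
right-extension-unique {T} A S d B₀ e (inj₂ unique) =
  subst (Unique T) (trans (cong (sub T (suc (length A))) (trans (sym (+-suc (length A) (length S)))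
                                                 (cong (length A +_) (sym (length-∷ʳ S d)))))
                          (sub-factorisation A (S ∷ʳ d) B₀ (trans e (cong (A ++_) (sym (∷ʳ-++ S d B₀))))))
        unique

net-occurrence : ∀ {T} (A S B : Word) → T ≡ A ++ S ++ B → IsNet T (suc (length A)) (length A + length S) →
                 NetOccurrence T A S B
net-occurrence {T} A S B split (_ , repeated , left , right)
  with A′ , B′ , split′ , distinct ←
         another-occurrence A S B split (subst (Repeated T) (sub-factorisation A S B split) repeated) = record
  { split        = split
  ; A′           = A′
  ; B′           = B′
  ; split′       = split′
  ; distinct     = distinct
  ; left-unique  = left-unique
  ; right-unique = right-unique
  }
  where
  left-unique : ∀ A₀ c → A ≡ A₀ ∷ʳ c → AtMostOnce T (c ∷ S)
  left-unique A₀ c refl = Unique⇒AtMostOnce (s≤s z≤n) (left-extension-unique A₀ c S B split left)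
  right-unique : ∀ d B₀ → B ≡ d ∷ B₀ → AtMostOnce T (S ∷ʳ d)
  right-unique d B₀ refl =
    Unique⇒AtMostOnce (subst (0 <_) (sym (length-∷ʳ S d)) (s≤s z≤n)) (right-extension-unique A S d B₀ split right)

infix-length : ∀ (A U W S : Word) → length (A ++ U) + length W ≤ length A + length S → length (U ++ W) ≤ length S
infix-length A U W S ≤S = +-cancelˡ-≤ (length A) (length (U ++ W)) (length S) (subst (_≤ length A + length S) |AUW| ≤S)
  where
  |AUW| : length (A ++ U) + length W ≡ length A + length (U ++ W)
  |AUW| = trans (cong (_+ length W) (length-++ A)) (trans (+-assoc (length A) _ _) (cong (length A +_) (sym (length-++ U))))

super-occurrence⇒infix : ∀ {T} (A S B A₂ W B₂ : Word) → T ≡ A ++ S ++ B → T ≡ A₂ ++ W ++ B₂ →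
  Super (suc (length A)) (length A + length S) (suc (length A₂)) (length A₂ + length W) →
  Σ Word λ U → Σ Word λ V → S ≡ U ++ W ++ V
super-occurrence⇒infix A S B A₂ W B₂ e e₂ (s≤s A≤A₂ , _ , end≤end)
  with U , refl , SB≡ ← ++-split-≤ A (S ++ B) A₂ (W ++ B₂) (trans (sym e) e₂) A≤A₂
  with V , S≡ , _ ← ++-split-≤ (U ++ W) B₂ S B (trans (++-assoc U W B₂) (sym SB≡)) (infix-length A U W S end≤end)
  = U , V , trans S≡ (++-assoc U W V)

record MaximalContext (X Y X′ Y′ : Word) : Set where
  field
    before before′ left right after after′ : Word
    before-left  : X ≡ before ++ left
    before-left′ : X′ ≡ before′ ++ left
    lasts-differ : ¬ SameLast before before′
    right-after  : Y ≡ right ++ after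
    right-after′ : Y′ ≡ right ++ after′
    heads-differ : ¬ SameHead after after′

swap : ∀ {X Y X′ Y′} → MaximalContext X Y X′ Y′ → MaximalContext X′ Y′ X Y
swap c = record
  { before = before′ ; before′ = before ; left = left ; right = right ; after = after′ ; after′ = after
  ; before-left = before-left′ ; before-left′ = before-left
  ; lasts-differ = λ (d , L₀ , L₀′ , e , e′) → lasts-differ (d , L₀′ , L₀ , e′ , e)
  ; right-after = right-after′ ; right-after′ = right-after
  ; heads-differ = λ (d , R₀ , R₀′ , e , e′) → heads-differ (d , R₀′ , R₀ , e′ , e)
  }
  where open MaximalContext c

module _ {T A S B : Word} (net : NetOccurrence T A S B) where
  open NetOccurrence net

  preceding-letters-differ : ¬ SameLast A A′
  preceding-letters-differ (c , A₀ , A₀′ , refl , refl) = distinct (begin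
    length (A₀ ∷ʳ c)   ≡⟨ length-∷ʳ A₀ c ⟩
    suc (length A₀)    ≡⟨ cong suc (left-unique A₀ c refl A₀ B A₀′ B′ (shift A₀ B split) (shift A₀′ B′ split′)) ⟩
    suc (length A₀′)   ≡⟨ sym (length-∷ʳ A₀′ c) ⟩
    length (A₀′ ∷ʳ c)  ∎)
    where
    open ≡-Reasoning
    shift : ∀ X Y → T ≡ (X ∷ʳ c) ++ S ++ Y → T ≡ X ++ (c ∷ S) ++ Y
    shift X Y e = trans e (++-assoc X (c ∷ []) (S ++ Y))

  following-letters-differ : ¬ SameHead B B′
  following-letters-differ (d , B₀ , B₀′ , refl , refl) =
    distinct (right-unique d B₀ refl A B₀ A′ B₀′ (shift A B₀ split) (shift A′ B₀′ split′))
    where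
    shift : ∀ X Y → T ≡ X ++ S ++ d ∷ Y → T ≡ X ++ (S ∷ʳ d) ++ Y
    shift X Y e = trans e (cong (X ++_) (sym (∷ʳ-++ S d Y)))

  maximal-repeat : ∀ {X Y X′ Y′} U Z → S ≡ U ++ Z →
    A ++ U ≡ X → A′ ++ U ≡ X′ → Z ++ B ≡ Y → Z ++ B′ ≡ Y′ →
    (c : MaximalContext X Y X′ Y′) →
    A ≡ MaximalContext.before c × S ≡ MaximalContext.left c ++ MaximalContext.right c × B ≡ MaximalContext.after c
  maximal-repeat U Z S≡ refl refl refl refl c
    with shared-suffix A A′ U before before′ left before-left before-left′ lasts-differ
       | shared-prefix Z B B′ right after after′ right-after right-after′ heads-differ
    where open MaximalContext c
  ... | inj₂ same | _         = ⊥-elim (preceding-letters-differ same)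
  ... | inj₁ _    | inj₂ same = ⊥-elim (following-letters-differ same)
  ... | inj₁ refl | inj₁ refl =
    ++-cancelʳ U A _ (MaximalContext.before-left c) , S≡ , ++-cancelˡ Z B _ (MaximalContext.right-after c)

suffix-after : ∀ {T} (A U Z B : Word) {S X Y} →
  T ≡ A ++ S ++ B → S ≡ U ++ Z → T ≡ X ++ Y → A ++ U ≡ X → Z ++ B ≡ Y
suffix-after A U Z B split refl T≡ refl = ++-cancelˡ (A ++ U) _ _ (trans reassoc (trans (sym split) T≡))
  where
  reassoc : (A ++ U) ++ Z ++ B ≡ A ++ (U ++ Z) ++ B
  reassoc = trans (++-assoc A U (Z ++ B)) (cong (A ++_) (sym (++-assoc U Z B)))

-- Fibonacci words and the morphism φ

flip : Letter → Letter
flip a = b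
flip b = a

-- F n ends with lastLetter n (for n ≥ 1).
lastLetter : ℕ → Letter
lastLetter zero          = a
lastLetter (suc zero)    = b
lastLetter (suc (suc n)) = lastLetter n

flip-lastLetter : ∀ n → flip (lastLetter (suc n)) ≡ lastLetter n
flip-lastLetter zero          = refl
flip-lastLetter (suc zero)    = refl
flip-lastLetter (suc (suc n)) = flip-lastLetter n

lastLetter-alternates : ∀ n → lastLetter n ≢ lastLetter (suc n)
lastLetter-alternates zero          ()
lastLetter-alternates (suc zero)    ()
lastLetter-alternates (suc (suc n)) = lastLetter-alternates n

F-almost-commute : ∀ n →
  F (3 + n) ++ F (2 + n) ≡ Q' (2 + n) ++ lastLetter (3 + n) ∷ lastLetter (2 + n) ∷ [] ×
  F (2 + n) ++ F (3 + n) ≡ Q' (2 + n) ++ lastLetter (2 + n) ∷ lastLetter (3 + n) ∷ []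
F-almost-commute zero    = refl , refl
F-almost-commute (suc n) with F₃F₂ , F₂F₃ ← F-almost-commute n =
  trans (++-assoc (F (3 + n)) (F (2 + n)) (F (3 + n)))
        (trans (cong (F (3 + n) ++_) F₂F₃) (sym (++-assoc (F (3 + n)) (Q' (2 + n)) _))) ,
  trans (cong (F (3 + n) ++_) F₃F₂) (sym (++-assoc (F (3 + n)) (Q' (2 + n)) _))

F-nonempty : ∀ n → 0 < length (F (suc n))
F-nonempty zero          = s≤s z≤n
F-nonempty (suc zero)    = s≤s z≤n
F-nonempty (suc (suc n)) = subst (0 <_) (sym (length-++ (F (2 + n))))
                                 (<-≤-trans (F-nonempty (suc n)) (m≤m+n _ _))

φ : Word → Word
φ []      = []
φ (a ∷ w) = a ∷ b ∷ φ w
φ (b ∷ w) = a ∷ φ w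

φ-++ : ∀ u v → φ (u ++ v) ≡ φ u ++ φ v
φ-++ []      v = refl
φ-++ (a ∷ u) v = cong (λ w → a ∷ b ∷ w) (φ-++ u v)
φ-++ (b ∷ u) v = cong (a ∷_) (φ-++ u v)

φ-F : ∀ n → φ (F (suc n)) ≡ F (2 + n)
φ-F zero          = refl
φ-F (suc zero)    = refl
φ-F (suc (suc n)) = trans (φ-++ (F (2 + n)) (F (suc n))) (cong₂ _++_ (φ-F (suc n)) (φ-F n))

φ-Q' : ∀ n → φ (Q' (suc n)) ∷ʳ a ≡ Q' (2 + n)
φ-Q' zero    = refl
φ-Q' (suc n) = begin
  φ (F (2 + n) ++ Q' (suc n)) ∷ʳ a       ≡⟨ cong (_∷ʳ a) (φ-++ (F (2 + n)) (Q' (suc n))) ⟩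
  (φ (F (2 + n)) ++ φ (Q' (suc n))) ∷ʳ a ≡⟨ ++-assoc (φ (F (2 + n))) _ _ ⟩
  φ (F (2 + n)) ++ φ (Q' (suc n)) ∷ʳ a   ≡⟨ cong₂ _++_ (φ-F (suc n)) (φ-Q' n) ⟩
  F (3 + n) ++ Q' (2 + n)                ∎
  where open ≡-Reasoning

φ-≢b∷ : ∀ u w → φ u ≢ b ∷ w
φ-≢b∷ (a ∷ u) w ()
φ-≢b∷ (b ∷ u) w ()

φ-injective : ∀ u v → φ u ≡ φ v → u ≡ v
φ-injective []      []      _ = refl
φ-injective []      (a ∷ v) ()
φ-injective []      (b ∷ v) ()
φ-injective (a ∷ u) []      ()
φ-injective (b ∷ u) []      ()
φ-injective (a ∷ u) (a ∷ v) e = cong (a ∷_) (φ-injective u v (∷-injectiveʳ (∷-injectiveʳ e)))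
φ-injective (b ∷ u) (b ∷ v) e = cong (b ∷_) (φ-injective u v (∷-injectiveʳ e))
φ-injective (a ∷ u) (b ∷ v) e = ⊥-elim (φ-≢b∷ v (φ u) (sym (∷-injectiveʳ e)))
φ-injective (b ∷ u) (a ∷ v) e = ⊥-elim (φ-≢b∷ u (φ v) (∷-injectiveʳ e))

φ-cut : ∀ T X R → φ T ≡ X ++ a ∷ R →
        Σ Word λ X₀ → Σ Word λ Z → T ≡ X₀ ++ Z × φ X₀ ≡ X × φ Z ≡ a ∷ R
φ-cut T       []          R e = [] , T , refl , refl , e
φ-cut (a ∷ T) (_ ∷ [])    R e with () ← ∷-injective (∷-injectiveʳ e)
φ-cut (a ∷ T) (_ ∷ _ ∷ X) R e with refl , e′ ← ∷-injective e
  with refl , e″ ← ∷-injective e′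
  with X₀ , Z , refl , refl , φZ ← φ-cut T X R e″ = a ∷ X₀ , Z , refl , refl , φZ
φ-cut (b ∷ T) (_ ∷ X)     R e with refl , e′ ← ∷-injective e
  with X₀ , Z , refl , refl , φZ ← φ-cut T X R e′ = b ∷ X₀ , Z , refl , refl , φZ

φ-starts-with-a : ∀ P R → Σ Word λ R′ → φ P ++ a ∷ R ≡ a ∷ R′
φ-starts-with-a []      R = R , refl
φ-starts-with-a (a ∷ P) R = _ , refl
φ-starts-with-a (b ∷ P) R = _ , refl

φ-first-letter : ∀ Z c R → φ Z ≡ a ∷ c ∷ R → Σ Word λ Z′ → Z ≡ flip c ∷ Z′
φ-first-letter (a ∷ Z) b R e = Z , refl
φ-first-letter (b ∷ Z) a R e = Z , refl
φ-first-letter (a ∷ Z) a R e with () ← ∷-injectiveˡ (∷-injectiveʳ e)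
φ-first-letter (b ∷ Z) b R e = ⊥-elim (φ-≢b∷ Z R (∷-injectiveʳ e))

φ-desubstitute : ∀ T X P c R → φ T ≡ X ++ φ P ++ a ∷ c ∷ R →
                 Σ Word λ X₀ → Σ Word λ Z → T ≡ X₀ ++ P ++ flip c ∷ Z × φ X₀ ≡ X
φ-desubstitute T X P c R e
  with R′ , starts-a ← φ-starts-with-a P (c ∷ R)
  with X₀ , Z , refl , refl , φZ ← φ-cut T X R′ (trans e (cong (X ++_) starts-a))
  with P′ , Z′ , refl , φP′ , φZ′ ← φ-cut Z (φ P) (c ∷ R) (trans φZ (sym starts-a))
  with refl ← φ-injective P′ P φP′
  with Z″ , refl ← φ-first-letter Z′ c R φZ′
  = X₀ , Z″ , refl , refl

-- Occurrences of F k in F (3 + k)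

_startsWith_ : Word → Word → Bool
T       startsWith []      = true
[]      startsWith (_ ∷ _) = false
(a ∷ T) startsWith (a ∷ W) = T startsWith W
(b ∷ T) startsWith (b ∷ W) = T startsWith W
(a ∷ _) startsWith (b ∷ _) = false
(b ∷ _) startsWith (a ∷ _) = false

++-startsWith : ∀ W Z → (W ++ Z) startsWith W ≡ true
++-startsWith []      Z = refl
++-startsWith (a ∷ W) Z = ++-startsWith W Z
++-startsWith (b ∷ W) Z = ++-startsWith W Z

atStart : Word → Word → List Word
atStart W T = if T startsWith W then [] ∷ [] else []

prefixesBefore : Word → Word → List Word
prefixesBefore W T = atStart W T ++ later T
  where
  later : Word → List Word
  later []      = []
  later (c ∷ T) = map (c ∷_) (prefixesBefore W T)

prefixesBefore-complete : ∀ W X Z → X ∈ prefixesBefore W (X ++ W ++ Z)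
prefixesBefore-complete W []      Z rewrite ++-startsWith W Z = here refl
prefixesBefore-complete W (c ∷ X) Z =
  ∈-++⁺ʳ (atStart W (c ∷ X ++ W ++ Z)) (∈-map⁺ (c ∷_) (prefixesBefore-complete W X Z))

data Slot : Set where
  s₀ s₁ s₂ s₃ : Slot

-- For k ≥ 4, F k occurs in F (3 + k) = F (1 + k) F k F (1 + k) exactly after these prefixes.
prefixAt : ℕ → Slot → Word
prefixAt k s₀ = []
prefixAt k s₁ = F k
prefixAt k s₂ = F (1 + k)
prefixAt k s₃ = F (2 + k)

AtSlot : ℕ → Word → Set
AtSlot k X = Σ Slot λ s → X ≡ prefixAt k s

φ-prefixAt : ∀ k s → φ (prefixAt (suc k) s) ≡ prefixAt (2 + k) s
φ-prefixAt k s₀ = refl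
φ-prefixAt k s₁ = φ-F k
φ-prefixAt k s₂ = φ-F (suc k)
φ-prefixAt k s₃ = φ-F (2 + k)

slot-listed : ∀ k {X} → X ∈ prefixAt k s₀ ∷ prefixAt k s₁ ∷ prefixAt k s₂ ∷ prefixAt k s₃ ∷ [] → AtSlot k X
slot-listed k (here e)                         = s₀ , e
slot-listed k (there (here e))                 = s₁ , e
slot-listed k (there (there (here e)))         = s₂ , e
slot-listed k (there (there (there (here e)))) = s₃ , e
slot-listed k (there (there (there (there ()))))

listed-occurrence : ∀ {T} W X Z → T ≡ X ++ W ++ Z → X ∈ prefixesBefore W T
listed-occurrence W X Z refl = prefixesBefore-complete W X Z

φ-Q'-∷ʳ : ∀ n c Z → (Q' (2 + n) ∷ʳ c) ++ Z ≡ φ (Q' (suc n)) ++ a ∷ c ∷ Z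
φ-Q'-∷ʳ n c Z = begin
  (Q' (2 + n) ∷ʳ c) ++ Z             ≡⟨ ∷ʳ-++ (Q' (2 + n)) c Z ⟩
  Q' (2 + n) ++ c ∷ Z                ≡⟨ cong (_++ c ∷ Z) (sym (φ-Q' n)) ⟩
  (φ (Q' (suc n)) ∷ʳ a) ++ c ∷ Z     ≡⟨ ∷ʳ-++ (φ (Q' (suc n))) a (c ∷ Z) ⟩
  φ (Q' (suc n)) ++ a ∷ c ∷ Z        ∎
  where open ≡-Reasoning

-- Q' (3 + n) ∷ʳ lastLetter (4 + n) is F (5 + n) without its last letter, which is dropped
-- because the image of a final b under φ may continue as the image of an a.
init-F-occurrence-at-slot : ∀ n X Z → F (8 + n) ≡ X ++ (Q' (3 + n) ∷ʳ lastLetter (4 + n)) ++ Z → AtSlot (5 + n) X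
init-F-occurrence-at-slot zero    X Z e = slot-listed 5 (listed-occurrence _ X Z e)
init-F-occurrence-at-slot (suc n) X Z e
  with X₀ , Z₀ , T≡ , refl ← φ-desubstitute (F (8 + n)) X (Q' (3 + n)) (lastLetter (5 + n)) Z
                               (trans (φ-F (7 + n)) (trans e (cong (X ++_) (φ-Q'-∷ʳ (2 + n) _ Z))))
  with s , refl ← init-F-occurrence-at-slot n X₀ Z₀
                    (trans T≡ (cong (X₀ ++_) (trans (cong (λ c → Q' (3 + n) ++ c ∷ Z₀) (flip-lastLetter (4 + n)))
                                                    (sym (∷ʳ-++ (Q' (3 + n)) _ Z₀)))))
  = s , φ-prefixAt (4 + n) s

F-occurrence-at-slot : ∀ n X Z → F (7 + n) ≡ X ++ F (4 + n) ++ Z → AtSlot (4 + n) X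
F-occurrence-at-slot zero    X Z e = slot-listed 4 (listed-occurrence _ X Z e)
F-occurrence-at-slot (suc n) X Z e = init-F-occurrence-at-slot n X (lastLetter (5 + n) ∷ Z) (trans e (cong (X ++_) F≡))
  where
  F≡ : F (5 + n) ++ Z ≡ (Q' (3 + n) ∷ʳ lastLetter (4 + n)) ++ lastLetter (5 + n) ∷ Z
  F≡ = begin
    F (5 + n) ++ Z                                                  ≡⟨ cong (_++ Z) (proj₁ (F-almost-commute (suc n))) ⟩
    (Q' (3 + n) ++ lastLetter (4 + n) ∷ lastLetter (5 + n) ∷ []) ++ Z ≡⟨ ++-assoc (Q' (3 + n)) _ Z ⟩
    Q' (3 + n) ++ lastLetter (4 + n) ∷ lastLetter (5 + n) ∷ Z       ≡⟨ sym (∷ʳ-++ (Q' (3 + n)) _ _) ⟩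
    (Q' (3 + n) ∷ʳ lastLetter (4 + n)) ++ lastLetter (5 + n) ∷ Z    ∎
    where open ≡-Reasoning

-- Net occurrences in F (7 + m)

module NetOccurrencesInF (m : ℕ) where

  -- In the names below a subscript n stands for n + m: F₅ is F (5 + m), Q'₃ is Q' (3 + m).

  x y : Letter
  x = lastLetter (4 + m)
  y = lastLetter (5 + m)

  x≢y : x ≢ y
  x≢y = lastLetter-alternates (4 + m)

  y≢x : y ≢ x
  y≢x y≡x = x≢y (sym y≡x)

  F₄≡ : F (4 + m) ≡ Q' (2 + m) ++ y ∷ x ∷ []
  F₄≡ = proj₁ (F-almost-commute m)

  F₅≡ : F (5 + m) ≡ Q' (3 + m) ++ x ∷ y ∷ []
  F₅≡ = proj₁ (F-almost-commute (1 + m))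

  F₃F₄≡ : F (3 + m) ++ F (4 + m) ≡ Q' (3 + m) ++ y ∷ x ∷ []
  F₃F₄≡ = proj₂ (F-almost-commute (1 + m))

  F₆≡ : F (6 + m) ≡ Q' (4 + m) ++ y ∷ x ∷ []
  F₆≡ = proj₁ (F-almost-commute (2 + m))

  F₄F₅≡ : F (4 + m) ++ F (5 + m) ≡ Q' (4 + m) ++ x ∷ y ∷ []
  F₄F₅≡ = proj₂ (F-almost-commute (2 + m))

  F₄F₅≡F₅F₂F₃ : F (4 + m) ++ F (5 + m) ≡ F (5 + m) ++ F (2 + m) ++ F (3 + m)
  F₄F₅≡F₅F₂F₃ = trans (cong (F (4 + m) ++_) (++-assoc (F (3 + m)) (F (2 + m)) (F (3 + m))))
                      (sym (++-assoc (F (4 + m)) (F (3 + m)) _))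

  suffixAt : Slot → Word
  suffixAt s₀ = F (7 + m)
  suffixAt s₁ = (F (3 + m) ++ F (4 + m)) ++ F (5 + m)
  suffixAt s₂ = F (4 + m) ++ F (5 + m)
  suffixAt s₃ = F (5 + m)

  F₇-split : ∀ s → F (7 + m) ≡ prefixAt (4 + m) s ++ suffixAt s
  F₇-split s₀ = refl
  F₇-split s₁ = trans (cong (_++ F (5 + m)) (++-assoc (F (4 + m)) (F (3 + m)) (F (4 + m))))
                      (++-assoc (F (4 + m)) (F (3 + m) ++ F (4 + m)) (F (5 + m)))
  F₇-split s₂ = ++-assoc (F (5 + m)) (F (4 + m)) (F (5 + m))
  F₇-split s₃ = refl

  F₇≡F₅F₄F₅ : F (7 + m) ≡ F (5 + m) ++ F (4 + m) ++ F (5 + m)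
  F₇≡F₅F₄F₅ = F₇-split s₂

  F₅-++ : ∀ R → F (5 + m) ++ R ≡ Q' (3 + m) ++ x ∷ y ∷ R
  F₅-++ R = trans (cong (_++ R) F₅≡) (++-assoc (Q' (3 + m)) _ R)

  F₃F₄-++ : ∀ R → (F (3 + m) ++ F (4 + m)) ++ R ≡ Q' (3 + m) ++ y ∷ x ∷ R
  F₃F₄-++ R = trans (cong (_++ R) F₃F₄≡) (++-assoc (Q' (3 + m)) _ R)

  context₀₁ : MaximalContext [] (F (7 + m)) (F (4 + m)) (suffixAt s₁)
  context₀₁ = record
    { before = [] ; before′ = F (4 + m) ; left = [] ; right = Q' (3 + m)
    ; after = x ∷ y ∷ F (4 + m) ++ F (5 + m) ; after′ = y ∷ x ∷ F (5 + m)
    ; before-left = refl ; before-left′ = sym (++-identityʳ _) ; lasts-differ = ¬SameLast-[]ˡ _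
    ; right-after = trans F₇≡F₅F₄F₅ (F₅-++ _) ; right-after′ = F₃F₄-++ _
    ; heads-differ = ¬SameHead-∷ x≢y
    }

  context₀₂ : MaximalContext [] (F (7 + m)) (F (5 + m)) (suffixAt s₂)
  context₀₂ = record
    { before = [] ; before′ = F (5 + m) ; left = [] ; right = Q' (4 + m)
    ; after = y ∷ x ∷ F (5 + m) ; after′ = x ∷ y ∷ []
    ; before-left = refl ; before-left′ = sym (++-identityʳ _) ; lasts-differ = ¬SameLast-[]ˡ _
    ; right-after = trans (cong (_++ F (5 + m)) F₆≡) (++-assoc (Q' (4 + m)) _ _) ; right-after′ = F₄F₅≡
    ; heads-differ = ¬SameHead-∷ y≢x
    }

  context₀₃ : MaximalContext [] (F (7 + m)) (F (6 + m)) (suffixAt s₃)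
  context₀₃ = record
    { before = [] ; before′ = F (6 + m) ; left = [] ; right = F (5 + m)
    ; after = F (4 + m) ++ F (5 + m) ; after′ = []
    ; before-left = refl ; before-left′ = sym (++-identityʳ _) ; lasts-differ = ¬SameLast-[]ˡ _
    ; right-after = F₇≡F₅F₄F₅ ; right-after′ = sym (++-identityʳ _)
    ; heads-differ = ¬SameHead-[]ʳ _
    }

  context₁₂ : MaximalContext (F (4 + m)) (suffixAt s₁) (F (5 + m)) (suffixAt s₂)
  context₁₂ = record
    { before = F (4 + m) ; before′ = F (5 + m) ; left = [] ; right = Q' (3 + m)
    ; after = y ∷ x ∷ F (5 + m) ; after′ = x ∷ y ∷ F (2 + m) ++ F (3 + m)
    ; before-left = sym (++-identityʳ _) ; before-left′ = sym (++-identityʳ _)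
    ; lasts-differ = ¬SameLast-∷ʳ x≢y (trans F₄≡ (ends-with (Q' (2 + m)) y x)) (trans F₅≡ (ends-with (Q' (3 + m)) x y))
    ; right-after = F₃F₄-++ _ ; right-after′ = trans F₄F₅≡F₅F₂F₃ (F₅-++ _)
    ; heads-differ = ¬SameHead-∷ y≢x
    }

  context₁₃ : MaximalContext (F (4 + m)) (suffixAt s₁) (F (6 + m)) (suffixAt s₃)
  context₁₃ = record
    { before = [] ; before′ = F (5 + m) ; left = F (4 + m) ; right = Q' (3 + m)
    ; after = y ∷ x ∷ F (5 + m) ; after′ = x ∷ y ∷ []
    ; before-left = refl ; before-left′ = refl ; lasts-differ = ¬SameLast-[]ˡ _
    ; right-after = F₃F₄-++ _ ; right-after′ = F₅≡
    ; heads-differ = ¬SameHead-∷ y≢x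
    }

  context₂₃ : MaximalContext (F (5 + m)) (suffixAt s₂) (F (6 + m)) (suffixAt s₃)
  context₂₃ = record
    { before = F (5 + m) ; before′ = F (6 + m) ; left = [] ; right = F (5 + m)
    ; after = F (2 + m) ++ F (3 + m) ; after′ = []
    ; before-left = sym (++-identityʳ _) ; before-left′ = sym (++-identityʳ _)
    ; lasts-differ = ¬SameLast-∷ʳ y≢x (trans F₅≡ (ends-with (Q' (3 + m)) x y)) (trans F₆≡ (ends-with (Q' (4 + m)) y x))
    ; right-after = F₄F₅≡F₅F₂F₃ ; right-after′ = sym (++-identityʳ _)
    ; heads-differ = ¬SameHead-[]ʳ _
    }

  |F₅|≢0 : length (F (5 + m)) ≢ 0
  |F₅|≢0 e = <-irrefl (sym e) (F-nonempty (4 + m))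

  F₅-∷ʳ : ∀ R → F (5 + m) ++ R ≡ (Q' (3 + m) ∷ʳ x) ++ y ∷ R
  F₅-∷ʳ R = trans (F₅-++ R) (sym (∷ʳ-++ (Q' (3 + m)) x (y ∷ R)))

  -- Q' (3 + m) x occurs at 0 and after F (5 + m).
  ¬net-Q'₃-before-x : ∀ {A B B₀} → NetOccurrence (F (7 + m)) A (Q' (3 + m)) B → B ≡ x ∷ B₀ → ⊥
  ¬net-Q'₃-before-x {B₀ = B₀} net B≡ = |F₅|≢0 (sym (NetOccurrence.right-unique net x B₀ B≡
    [] (y ∷ F (4 + m) ++ F (5 + m)) (F (5 + m)) (y ∷ F (2 + m) ++ F (3 + m))
    (trans F₇≡F₅F₄F₅ (F₅-∷ʳ _))
    (trans F₇≡F₅F₄F₅ (cong (F (5 + m) ++_) (trans F₄F₅≡F₅F₂F₃ (F₅-∷ʳ _))))))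

  H : Word
  H = Q' (2 + m) ∷ʳ y

  F₄≡H∷ʳx : F (4 + m) ≡ H ∷ʳ x
  F₄≡H∷ʳx = trans F₄≡ (ends-with (Q' (2 + m)) y x)

  F₄-++ : ∀ R → F (4 + m) ++ Q' (3 + m) ++ R ≡ H ++ (x ∷ Q' (3 + m)) ++ R
  F₄-++ R = trans (cong (_++ Q' (3 + m) ++ R) F₄≡H∷ʳx) (++-assoc H (x ∷ []) _)

  -- x Q' (3 + m) occurs after H and after F (5 + m) H.
  ¬net-Q'₃-after-F₄ : ∀ {A B} → NetOccurrence (F (7 + m)) A (Q' (3 + m)) B → A ≡ F (4 + m) → ⊥
  ¬net-Q'₃-after-F₄ net A≡ =
    |F₅|≢0 (+-cancelʳ-≡ (length H) (length (F (5 + m))) 0 (sym (trans once (length-++ (F (5 + m))))))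
    where
    once : length H ≡ length (F (5 + m) ++ H)
    once = NetOccurrence.left-unique net H x (trans A≡ F₄≡H∷ʳx)
      H (y ∷ x ∷ F (5 + m)) (F (5 + m) ++ H) (x ∷ y ∷ [])
      (trans (F₇-split s₁) (trans (cong (F (4 + m) ++_) (F₃F₄-++ _)) (F₄-++ _)))
      (trans F₇≡F₅F₄F₅ (trans (cong (λ R → F (5 + m) ++ F (4 + m) ++ R) F₅≡)
                              (trans (cong (F (5 + m) ++_) (F₄-++ _)) (sym (++-assoc (F (5 + m)) H _)))))

  Q'₄≡F₅Q'₂ : Q' (4 + m) ≡ F (5 + m) ++ Q' (2 + m)
  Q'₄≡F₅Q'₂ = sym (++-assoc (F (4 + m)) (F (3 + m)) (Q' (2 + m)))

  module _ {A S B : Word} (U V : Word) (net : NetOccurrence (F (7 + m)) A S B) (S≡ : S ≡ U ++ F (4 + m) ++ V) where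
    open NetOccurrence net

    covered-slot : ∀ {A″ B″} → F (7 + m) ≡ A″ ++ S ++ B″ → AtSlot (4 + m) (A″ ++ U)
    covered-slot {A″} {B″} e =
      F-occurrence-at-slot m (A″ ++ U) (V ++ B″) (trans e (trans (cong (λ S → A″ ++ S ++ B″) S≡) reassoc))
      where
      reassoc : A″ ++ (U ++ F (4 + m) ++ V) ++ B″ ≡ (A″ ++ U) ++ F (4 + m) ++ V ++ B″
      reassoc = trans (cong (A″ ++_) (trans (++-assoc U _ B″) (cong (U ++_) (++-assoc (F (4 + m)) V B″))))
                      (sym (++-assoc A″ U _))

    repeat : ∀ s s′ → A ++ U ≡ prefixAt (4 + m) s → A′ ++ U ≡ prefixAt (4 + m) s′ →
      (c : MaximalContext (prefixAt (4 + m) s) (suffixAt s) (prefixAt (4 + m) s′) (suffixAt s′)) →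
      A ≡ MaximalContext.before c × S ≡ MaximalContext.left c ++ MaximalContext.right c × B ≡ MaximalContext.after c
    repeat s s′ e e′ = maximal-repeat net U (F (4 + m) ++ V) S≡ e e′
      (suffix-after A U (F (4 + m) ++ V) B split S≡ (F₇-split s) e)
      (suffix-after A′ U (F (4 + m) ++ V) B′ split′ S≡ (F₇-split s′) e′)

    net-at-Q'₃ : S ≡ Q' (3 + m) → NetOccurrence (F (7 + m)) A (Q' (3 + m)) B
    net-at-Q'₃ S≡Q' = subst (λ S → NetOccurrence (F (7 + m)) A S B) S≡Q' net

    shape : ∀ s s′ → A ++ U ≡ prefixAt (4 + m) s → A′ ++ U ≡ prefixAt (4 + m) s′ →
      (c : MaximalContext (prefixAt (4 + m) s) (suffixAt s) (prefixAt (4 + m) s′) (suffixAt s′)) →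
      S ≡ MaximalContext.left c ++ MaximalContext.right c
    shape s s′ e e′ c = proj₁ (proj₂ (repeat s s′ e e′ c))

    same-slot : ∀ {X} → A ++ U ≡ X → A′ ++ U ≡ X → ⊥
    same-slot e e′ = distinct (cong length (++-cancelʳ U A A′ (trans e (sym e′))))

    classify : AtSlot (4 + m) (A ++ U) → AtSlot (4 + m) (A′ ++ U) →
               S ≡ F (5 + m) ⊎ S ≡ F (5 + m) ++ Q' (2 + m)
    classify (s₀ , e) (s₀ , e′) = ⊥-elim (same-slot e e′)
    classify (s₁ , e) (s₁ , e′) = ⊥-elim (same-slot e e′)
    classify (s₂ , e) (s₂ , e′) = ⊥-elim (same-slot e e′)
    classify (s₃ , e) (s₃ , e′) = ⊥-elim (same-slot e e′)
    classify (s₀ , e) (s₃ , e′) = inj₁ (shape s₀ s₃ e e′ context₀₃)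
    classify (s₃ , e) (s₀ , e′) = inj₁ (shape s₃ s₀ e e′ (swap context₀₃))
    classify (s₂ , e) (s₃ , e′) = inj₁ (shape s₂ s₃ e e′ context₂₃)
    classify (s₃ , e) (s₂ , e′) = inj₁ (shape s₃ s₂ e e′ (swap context₂₃))
    classify (s₀ , e) (s₂ , e′) = inj₂ (trans (shape s₀ s₂ e e′ context₀₂) Q'₄≡F₅Q'₂)
    classify (s₂ , e) (s₀ , e′) = inj₂ (trans (shape s₂ s₀ e e′ (swap context₀₂)) Q'₄≡F₅Q'₂)
    classify (s₁ , e) (s₃ , e′) = inj₂ (trans (shape s₁ s₃ e e′ context₁₃) Q'₄≡F₅Q'₂)
    classify (s₃ , e) (s₁ , e′) = inj₂ (trans (shape s₃ s₁ e e′ (swap context₁₃)) Q'₄≡F₅Q'₂)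
    classify (s₀ , e) (s₁ , e′) with _ , S≡Q' , B≡ ← repeat s₀ s₁ e e′ context₀₁ =
      ⊥-elim (¬net-Q'₃-before-x (net-at-Q'₃ S≡Q') B≡)
    classify (s₂ , e) (s₁ , e′) with _ , S≡Q' , B≡ ← repeat s₂ s₁ e e′ (swap context₁₂) =
      ⊥-elim (¬net-Q'₃-before-x (net-at-Q'₃ S≡Q') B≡)
    classify (s₁ , e) (s₀ , e′) with A≡ , S≡Q' , _ ← repeat s₁ s₀ e e′ (swap context₀₁) =
      ⊥-elim (¬net-Q'₃-after-F₄ (net-at-Q'₃ S≡Q') A≡)
    classify (s₁ , e) (s₂ , e′) with A≡ , S≡Q' , _ ← repeat s₁ s₂ e e′ context₁₂ =
      ⊥-elim (¬net-Q'₃-after-F₄ (net-at-Q'₃ S≡Q') A≡)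

    net-occurrence-covering-F : S ≡ F (5 + m) ⊎ S ≡ F (5 + m) ++ Q' (2 + m)
    net-occurrence-covering-F = classify (covered-slot split) (covered-slot split′)

lemma31 : (i : ℕ) → 7 ≤ i → (s e : ℕ) → IsOcc (F i) s e →
    (Σ ℕ λ s' → Σ ℕ λ e' → OccOf (F i) (F (i ∸ 3)) s' e' × Super s e s' e') →
    ¬ (sub (F i) s e ≡ F (i ∸ 2)) →
    ¬ (sub (F i) s e ≡ F (i ∸ 2) ++ Q i) →
    ¬ IsNet (F i) s e
lemma31 _ (s≤s (s≤s (s≤s (s≤s (s≤s (s≤s (s≤s (z≤n {m})))))))) s e occ (_ , _ , occ-F , super) S≢F₅ S≢F₅Q isNet
  with A , B , split , refl , e≡ ← occurrence⇒factorisation {F (7 + m)} (occ , refl)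
  with A₂ , B₂ , split₂ , refl , refl ← occurrence⇒factorisation occ-F
  with U , V , S≡ ← super-occurrence⇒infix A _ B A₂ (F (4 + m)) B₂ split split₂ (subst (λ e → Super _ e _ _) e≡ super)
  = [ S≢F₅ , S≢F₅Q ]′ (net-occurrence-covering-F m U V (net-occurrence A _ B split (subst (IsNet _ _) e≡ isNet)) S≡)
  where open NetOccurrencesInF using (net-occurrence-covering-F)
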